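{- Let $k$ be a nonnegative integer. Then $f(k+1,k) = k+1$. Furthermore, for every integer $m \geq k+1$, $f(m,k) = k+1$.
   Context: A tournament is a directed graph obtained by orienting each edge of a complete graph (no loops). In a tournament, a vertex $u$ dominates a set of vertices $U$ (written $u \rightarrow U$) if $(u,w)$ is an edge for every $w \in U$ (in particular $u \notin U$). Let $\tau = \{T_1, \dots, T_m\}$ be a collection of $m$ labeled tournaments, all on the same vertex set $V(\tau)$ (repetitions among the $T_i$ allowed). The collection $\tau$ has Schütte's property $S_k$ if for every $k$-element subset $U \subseteq V(\tau)$ there exist an index $i$ and a vertex $u \in V(\tau)$ with $u \rightarrow U$ in $T_i$. For positive integers $m$ and nonnegative integers $k$, $f(m,k)$ denotes the minimum size of a vertex set $V$ such that there is a collection of $m$ tournaments on $V$ having property $S_k$. -}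

module Defs where

open import Data.Nat using (ℕ; _≤_)
open import Data.Bool using (Bool; true; false; not)
open import Data.Fin using (Fin)
open import Data.Fin.Subset using (Subset; _∈_; ∣_∣)
open import Data.Product using (Σ; _×_; ∃-syntax)
open import Relation.Binary.PropositionalEquality using (_≡_; _≢_)

record Tournament (n : ℕ) : Set where
  field
    adj    : Fin n → Fin n → Bool
    irrefl : ∀ u → adj u u ≡ false
    tourn  : ∀ u v → u ≢ v → adj v u ≡ not (adj u v)
open Tournament public

-- u → U in T : (u,w) is an edge for every w ∈ U (hence u ∉ U by irreflexivity)
Dominates : ∀ {n} → Tournament n → Fin n → Subset n → Set
Dominates T u U = ∀ w → w ∈ U → adj T u w ≡ true

HasSchutte : ∀ {m n} → (Fin m → Tournament n) → ℕ → Set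
HasSchutte {m} {n} τ k =
  ∀ (U : Subset n) → ∣ U ∣ ≡ k → ∃[ i ] ∃[ u ] Dominates (τ i) u U

-- There is a collection of m tournaments on an n-element vertex set with S_k.
-- Convention: the vertex set must have at least k elements (otherwise S_k
-- holds vacuously and f would be trivial).
Realizable : ℕ → ℕ → ℕ → Set
Realizable m k n = (k ≤ n) × Σ (Fin m → Tournament n) (λ τ → HasSchutte τ k)

fEq : ℕ → ℕ → ℕ → Set
fEq m k v = Realizable m k v × (∀ n → Realizable m k n → v ≤ n)

-- On k vertices S_k fails: for U the whole vertex set a
-- dominating vertex would dominate itself.  On k + 1 vertices every
-- k-set U misses some vertex s, and s dominates U in the transitive
-- tournament whose ranking puts s first; with m ≥ k + 1 tournaments
-- there is room for one such tournament per vertex.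
module Submission where

open import Defs
open import Data.Bool using (false; not)
open import Data.Empty using (⊥-elim)
open import Data.Fin using (Fin; zero; suc; toℕ; inject≤)
open import Data.Fin.Permutation.Components using (transpose; transpose-inverse)
open import Data.Fin.Properties using (_≟_; toℕ-injective; toℕ-fromℕ<; toℕ-inject≤; toℕ<n)
open import Data.Fin.Subset using (Subset; _∈_; _∉_; ∣_∣; ⊤; inside; outside)
open import Data.Fin.Subset.Properties using (∣⊤∣≡n; ∈⊤; drop-there)
open import Data.Nat using (ℕ; zero; suc; _≤_; _<_; _<ᵇ_; s≤s; _%_)
open import Data.Nat.DivMod using (_mod_; m<n⇒m%n≡m)
open import Data.Nat.Properties using (≤-refl; ≤-reflexive; n≤1+n; ≤∧≢⇒<)
open import Data.Product using (_×_; _,_; ∃-syntax)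
open import Data.Vec using (_∷_)
open import Function using (_∘_)
open import Function.Definitions using (Injective; StrictlySurjective)
open import Relation.Binary.PropositionalEquality
  using (_≡_; _≢_; refl; sym; trans; cong; subst; module ≡-Reasoning)
open import Relation.Nullary using (¬_)
open import Relation.Nullary.Decidable using (dec-true)

n<ᵇn≡false : ∀ n → (n <ᵇ n) ≡ false
n<ᵇn≡false zero          = refl
n<ᵇn≡false (suc zero)    = refl
n<ᵇn≡false (suc (suc n)) = n<ᵇn≡false (suc n)

m≢n⇒n<ᵇm≡not[m<ᵇn] : ∀ m n → m ≢ n → (n <ᵇ m) ≡ not (m <ᵇ n)
m≢n⇒n<ᵇm≡not[m<ᵇn] zero    zero    m≢n = ⊥-elim (m≢n refl)
m≢n⇒n<ᵇm≡not[m<ᵇn] zero    (suc n) _   = refl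
m≢n⇒n<ᵇm≡not[m<ᵇn] (suc m) zero    _   = refl
m≢n⇒n<ᵇm≡not[m<ᵇn] (suc m) (suc n) m≢n = m≢n⇒n<ᵇm≡not[m<ᵇn] m n (m≢n ∘ cong suc)

rankTournament : ∀ {n} (rank : Fin n → ℕ) → Injective _≡_ _≡_ rank → Tournament n
rankTournament rank rank-injective = record
  { adj    = λ u w → rank u <ᵇ rank w
  ; irrefl = λ u → n<ᵇn≡false (rank u)
  ; tourn  = λ u w u≢w → m≢n⇒n<ᵇm≡not[m<ᵇn] (rank u) (rank w) (u≢w ∘ rank-injective)
  }

transpose-injective : ∀ {n} (i j : Fin n) → Injective _≡_ _≡_ (transpose i j)
transpose-injective i j {x} {y} eq = begin
  x                                  ≡⟨ sym (transpose-inverse j i) ⟩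
  transpose j i (transpose i j x)    ≡⟨ cong (transpose j i) eq ⟩
  transpose j i (transpose i j y)    ≡⟨ transpose-inverse j i ⟩
  y                                  ∎
  where open ≡-Reasoning

transpose-self : ∀ {n} (i j : Fin n) → transpose i j i ≡ j
transpose-self i j rewrite dec-true (i ≟ i) refl = refl

-- The transposition of s and zero ranks s first.
sourceTournament : ∀ {n} → Fin (suc n) → Tournament (suc n)
sourceTournament s =
  rankTournament (toℕ ∘ transpose s zero) (transpose-injective s zero ∘ toℕ-injective)

sourceTournament-dominates : ∀ {n} (s : Fin (suc n)) (U : Subset (suc n)) →
                             s ∉ U → Dominates (sourceTournament s) s U
sourceTournament-dominates s U s∉U w w∈U
  rewrite transpose-self s zero with transpose s zero w in eq
... | zero  = ⊥-elim (s∉U (subst (_∈ U) w≡s w∈U))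
  where
  w≡s : w ≡ s
  w≡s = transpose-injective s zero (trans eq (sym (transpose-self s zero)))
... | suc _ = refl

∣p∣<n⇒∃∉ : ∀ {n} (p : Subset n) → ∣ p ∣ < n → ∃[ v ] v ∉ p
∣p∣<n⇒∃∉ (outside ∷ p) _ = zero , λ ()
∣p∣<n⇒∃∉ (inside  ∷ p) (s≤s ∣p∣<n) with ∣p∣<n⇒∃∉ p ∣p∣<n
... | v , v∉p = suc v , v∉p ∘ drop-there

sourceFamily-hasSchutte : ∀ {m k} (σ : Fin m → Fin (suc k)) → StrictlySurjective _≡_ σ →
                          HasSchutte (sourceTournament ∘ σ) k
sourceFamily-hasSchutte σ σ-surjective U ∣U∣≡k with ∣p∣<n⇒∃∉ U (≤-reflexive (cong suc ∣U∣≡k))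
... | s , s∉U with σ-surjective s
...   | i , refl = i , σ i , sourceTournament-dominates (σ i) U s∉U

mod-strictlySurjective : ∀ {m n} → suc n ≤ m →
                         StrictlySurjective _≡_ (λ (i : Fin m) → toℕ i mod suc n)
mod-strictlySurjective {n = n} n<m v = inject≤ v n<m , toℕ-injective (begin
  toℕ (toℕ (inject≤ v n<m) mod suc n) ≡⟨ toℕ-fromℕ< _ ⟩
  toℕ (inject≤ v n<m) % suc n         ≡⟨ m<n⇒m%n≡m inject≤v<1+n ⟩
  toℕ (inject≤ v n<m)                 ≡⟨ toℕ-inject≤ v n<m ⟩
  toℕ v                               ∎)
  where
  open ≡-Reasoning
  inject≤v<1+n : toℕ (inject≤ v n<m) < suc n
  inject≤v<1+n = subst (_< suc n) (sym (toℕ-inject≤ v n<m)) (toℕ<n v)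

realizable-1+k : ∀ {m k} → suc k ≤ m → Realizable m k (suc k)
realizable-1+k {k = k} k<m =
  n≤1+n k
  , (sourceTournament ∘ λ i → toℕ i mod suc k)
  , sourceFamily-hasSchutte _ (mod-strictlySurjective k<m)

¬hasSchutte-all : ∀ {m n} (τ : Fin m → Tournament n) → ¬ HasSchutte τ n
¬hasSchutte-all {n = n} τ S with S ⊤ (∣⊤∣≡n n)
... | i , u , u→⊤ with trans (sym (u→⊤ u ∈⊤)) (irrefl (τ i) u)
...   | ()

realizable⇒k<n : ∀ {m k n} → Realizable m k n → k < n
realizable⇒k<n (k≤n , τ , S) = ≤∧≢⇒< k≤n λ { refl → ¬hasSchutte-all τ S }

proposition2p4 : (k : ℕ) →
    fEq (suc k) k (suc k) × ((m : ℕ) → suc k ≤ m → fEq m k (suc k))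
proposition2p4 k = f≡1+k (suc k) ≤-refl , f≡1+k
  where
  f≡1+k : (m : ℕ) → suc k ≤ m → fEq m k (suc k)
  f≡1+k m k<m = realizable-1+k k<m , λ n → realizable⇒k<n
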